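{- Fix an integer $n$. Define matrices $C_t$ for $t\in\mathbb{Q}\cap[0,1]$ by $C_{0/1}=A(n)_q$, $C_{1/1}=B(n)_q$, and $C_{\frac{r+r'}{s+s'}}=C_{r/s}\,C_{r'/s'}$ for every pair of Farey neighbours $\frac rs<\frac{r'}{s'}$ in $[0,1]$. Then for every $t\in\mathbb{Q}\cap[0,1]$, $$\mathrm{Tr}(C_t)=q^{ -1}[3]_q\,m^t_q .$$ In particular this trace does not depend on $n$.
   Context: Let $q$ be a formal variable, $[k]_q=\frac{q^k-1}{q-1}$ for $k\in\mathbb{Z}$ (so $[3]_q=q^2+q+1$). For $n\in\mathbb{Z}$ let $$A(n)_q=\begin{pmatrix} q^{2-n}[n]_q & q^{1-n}\\ [n]_q[3-n]_q-q^{n-1} & q^{ -1}[3-n]_q\end{pmatrix},\qquad B(n)_q=A(n)_q\,A(n+1)_q$$ (these are $q$-deformations, with determinant $1$, of the classical Cohn matrices $A(n)=\begin{pmatrix} n&1\\3n-n^2-1&3-n\end{pmatrix}$, $B(n)=A(n)A(n+1)$). Two rationals $\frac{r}{s}<\frac{r'}{s'}$ in $[0,1]$, written in lowest terms with $s,s'>0$, are Farey neighbours if $r's-rs'=1$; every rational in $(0,1)$ is the mediant $\frac{r+r'}{s+s'}$ of exactly one pair of Farey neighbours in $[0,1]$. The $q$-Markov numbers $m^t_q\in\mathbb{Z}[q^{\pm1}]$, for $t\in(\mathbb{Q}\cap[0,1])\cup\{\frac10\}$, are defined recursively by $m^{0/1}_q=1$, $m^{1/1}_q=q+q^{ -1}$,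 $m^{1/0}_q=1$, and, for Farey neighbours $\frac rs<\frac{r'}{s'}$ in $[0,1]$, $$m_q^{\frac{r+r'}{s+s'}}=q^{ -1}[3]_q\,m_q^{r/s}\,m_q^{r'/s'}-m_q^{\frac{r'-r}{s'-s}},$$ where $\frac{r'-r}{s'-s}$ is understood as the rational number it represents (it is $\frac10$ for the pair $\frac01,\frac11$). -}

module Defs where

open import Algebra.Bundles using (CommutativeRing)
open import Data.Nat as ℕ using (ℕ; zero; suc; _≡ᵇ_; _<ᵇ_)
open import Data.Integer as ℤ using (ℤ; +_; -[1+_])
open import Data.Rational using (ℚ; ↥_; ↧ₙ_)
open import Data.List using (List; []; _∷_)
open import Data.Bool using (if_then_else_)

-- Directions in the Farey (Stern–Brocot) tree below the interval [0/1, 1/1].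
data Dir : Set where
  L R : Dir

-- Position of a rational t ∈ [0,1]: the endpoint 0/1, the endpoint 1/1, or an
-- interior point, given by the path of left/right descents from the root pair
-- of Farey neighbours (0/1, 1/1) to the unique pair of Farey neighbours of which
-- t is the mediant.
data Pos : Set where
  zeroPt onePt : Pos
  inner : List Dir → Pos

-- Descend towards a/b from the Farey neighbours r/s < r'/s' (fuel-bounded;
-- fuel = b suffices, since the mediant denominator increases at every step).
fareyPath : ℕ → (a b r s r' s' : ℕ) → List Dir
fareyPath zero    a b r s r' s' = []
fareyPath (suc f) a b r s r' s' =
  let x = a ℕ.* (s ℕ.+ s')
      y = b ℕ.* (r ℕ.+ r')
  in if x ≡ᵇ y then []
     else if x <ᵇ y then L ∷ fareyPath f a b r s (r ℕ.+ r') (s ℕ.+ s')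
     else R ∷ fareyPath f a b (r ℕ.+ r') (s ℕ.+ s') r' s'

position : ℚ → Pos
position t =
  let a = ℤ.∣ ↥ t ∣
      b = ↧ₙ t
  in if a ≡ᵇ 0 then zeroPt
     else if a ≡ᵇ b then onePt
     else inner (fareyPath b a b 0 1 1 1)

-- Everything below lives in an arbitrary commutative ring with a chosen q and
-- a chosen q⁻ (the theorem assumes q * q⁻ ≈ 1); this models ℤ[q^{±1}].
module QMarkov {c ℓ} (Rg : CommutativeRing c ℓ) (q q⁻ : CommutativeRing.Carrier Rg) where
  open CommutativeRing Rg

  pow : ℕ → Carrier → Carrier
  pow zero    x = 1#
  pow (suc k) x = x * pow k x

  qpow : ℤ → Carrier
  qpow (+ k)      = pow k q
  qpow -[1+ k ]   = pow (suc k) q⁻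

  -- [k]_q = (q^k - 1)/(q - 1): for k ≥ 0 this is 1 + q + … + q^{k-1};
  -- for k = -(j+1) it is -q^{-(j+1)} [j+1]_q.
  qnatP : ℕ → Carrier
  qnatP zero    = 0#
  qnatP (suc k) = pow k q + qnatP k

  qint : ℤ → Carrier
  qint (+ k)    = qnatP k
  qint -[1+ j ] = - (pow (suc j) q⁻ * qnatP (suc j))

  record M2 : Set c where
    constructor mat
    field
      a11 a12 a21 a22 : Carrier

  _⊗_ : M2 → M2 → M2
  mat a b c' d ⊗ mat e f g h =
    mat (a * e + b * g) (a * f + b * h) (c' * e + d * g) (c' * f + d * h)

  tr : M2 → Carrier
  tr (mat a _ _ d) = a + d

  A : ℤ → M2
  A n = mat (qpow (+ 2 ℤ.- n) * qint n)
            (qpow (+ 1 ℤ.- n))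
            (qint n * qint (+ 3 ℤ.- n) - qpow (n ℤ.- + 1))
            (q⁻ * qint (+ 3 ℤ.- n))

  B : ℤ → M2
  B n = A n ⊗ A (n ℤ.+ + 1)

  κ : Carrier
  κ = q⁻ * qint (+ 3)

  -- q-Markov numbers.  State: (m at left neighbour, m at right neighbour,
  -- m at (r'-r)/(s'-s)).  Going left to (L, M) the new difference point is R;
  -- going right to (M, R) it is L.
  mNode : List Dir → (mL mR mD : Carrier) → Carrier
  mNode []      mL mR mD = κ * mL * mR - mD
  mNode (L ∷ p) mL mR mD = mNode p mL (κ * mL * mR - mD) mR
  mNode (R ∷ p) mL mR mD = mNode p (κ * mL * mR - mD) mR mL

  mq : ℚ → Carrier
  mq t with position t
  ... | zeroPt  = 1#
  ... | onePt   = q + q⁻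
  ... | inner p = mNode p 1# (q + q⁻) 1#

  CNode : List Dir → (CL CR : M2) → M2
  CNode []      CL CR = CL ⊗ CR
  CNode (L ∷ p) CL CR = CNode p CL (CL ⊗ CR)
  CNode (R ∷ p) CL CR = CNode p (CL ⊗ CR) CR

  C : ℤ → ℚ → M2
  C n t with position t
  ... | zeroPt  = A n
  ... | onePt   = B n
  ... | inner p = CNode p (A n) (B n)

module Submission where

-- A(n) has determinant 1 and trace κ = q⁻¹[3]_q, and also
-- tr (A(n)⁻¹ A(n+1)) = κ, so the pair (A(n), A(n+1)) carries the q-Markov data
-- (1, 1, 1).  For determinant-one matrices the Fricke identity
-- tr (XY) = tr X · tr Y − tr (X⁻¹Y) is, after dividing traces by κ, exactly the
-- q-Markov recursion m = κ m_L m_R − m_D.  A pair (X, Y) with traces κ m_L, κ m_R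
-- and tr (X⁻¹Y) = κ m_D passes this property on to (X, XY) and (XY, Y), because
-- tr (X⁻¹XY) = tr Y and tr ((XY)⁻¹Y) = tr X; so it survives the whole descent
-- down the Farey tree.  The facts about A(n) are Laurent-polynomial identities in
-- q, q⁻ⁿ and [n]_q, using only that k ↦ q^k is a homomorphism and
-- [a + b]_q = [a]_q + q^a [b]_q.

open import Defs

open import Algebra.Bundles using (CommutativeRing)
open import Algebra.Solver.Ring.AlmostCommutativeRing
  using (fromCommutativeRing; _-Raw-AlmostCommutative⟶_)
open import Data.Integer as ℤ using (ℤ; +_; -[1+_]; _⊖_; _◃_; sign; ∣_∣; pred)
  renaming (suc to sucℤ)
import Data.Integer.Properties as ℤ
open import Data.List using ([]; _∷_)
open import Data.Maybe using (Maybe; just; nothing)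
open import Data.Nat as ℕ using (ℕ; zero; suc)
import Data.Nat.Properties as ℕ
open import Data.Rational using (ℚ; _≤_; 0ℚ; 1ℚ)
open import Data.Sign as Sign using (Sign)
open import Relation.Binary.PropositionalEquality as ≡ using (_≡_)
open import Relation.Nullary using (yes; no)

module IntegerRingSolver {c ℓ} (Rg : CommutativeRing c ℓ) where
  open CommutativeRing Rg
  open import Algebra.Properties.Ring ring
  open import Algebra.Properties.CommutativeSemigroup +-commutativeSemigroup
    using () renaming (interchange to +-interchange)
  open import Algebra.Properties.CommutativeSemigroup *-commutativeSemigroup
    using () renaming (interchange to *-interchange)
  open import Algebra.Properties.Semiring.Mult.TCOptimised semiring
  open import Relation.Binary.Reasoning.Setoid setoid

  -- The optimised multiple (1 × x = x) makes the solver constant con (+ 1)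
  -- denote 1# itself, so that solver goals match terms containing 1#.
  ⟦_⟧ℤ : ℤ → Carrier
  ⟦ + n ⟧ℤ      = n × 1#
  ⟦ -[1+ n ] ⟧ℤ = - (suc n × 1#)

  ⊖-homo : ∀ m n → ⟦ m ⊖ n ⟧ℤ ≈ m × 1# - n × 1#
  ⊖-homo m       zero    = sym (trans (+-congˡ -0#≈0#) (+-identityʳ _))
  ⊖-homo zero    (suc n) = sym (+-identityˡ _)
  ⊖-homo (suc m) (suc n) = begin
    ⟦ suc m ⊖ suc n ⟧ℤ               ≡⟨ ≡.cong ⟦_⟧ℤ (ℤ.[1+m]⊖[1+n]≡m⊖n m n) ⟩
    ⟦ m ⊖ n ⟧ℤ                       ≈⟨ ⊖-homo m n ⟩
    m × 1# - n × 1#                  ≈⟨ +-identityˡ _ ⟨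
    0# + (m × 1# - n × 1#)           ≈⟨ +-congʳ (-‿inverseʳ 1#) ⟨
    (1# - 1#) + (m × 1# - n × 1#)    ≈⟨ +-interchange _ _ _ _ ⟩
    (1# + m × 1#) + (- 1# - n × 1#)  ≈⟨ +-congˡ (-‿+-comm 1# (n × 1#)) ⟩
    (1# + m × 1#) - (1# + n × 1#)    ≈⟨ +-cong (1+× m 1#) (-‿cong (1+× n 1#)) ⟨
    suc m × 1# - suc n × 1#          ∎

  +-homo : ∀ i j → ⟦ i ℤ.+ j ⟧ℤ ≈ ⟦ i ⟧ℤ + ⟦ j ⟧ℤ
  +-homo (+ m)    (+ n)    = ×-homo-+ 1# m n
  +-homo (+ m)    -[1+ n ] = ⊖-homo m (suc n)
  +-homo -[1+ m ] (+ n)    = trans (⊖-homo n (suc m)) (+-comm _ _)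
  +-homo -[1+ m ] -[1+ n ] = begin
    - (suc (suc m ℕ.+ n) × 1#)     ≡⟨ ≡.cong (λ k → - (k × 1#)) (ℕ.+-suc (suc m) n) ⟨
    - ((suc m ℕ.+ suc n) × 1#)     ≈⟨ -‿cong (×-homo-+ 1# (suc m) (suc n)) ⟩
    - (suc m × 1# + suc n × 1#)    ≈⟨ -‿+-comm _ _ ⟨
    - (suc m × 1#) - (suc n × 1#)  ∎

  ⟦_⟧ₛ : Sign → Carrier
  ⟦ Sign.+ ⟧ₛ = 1#
  ⟦ Sign.- ⟧ₛ = - 1#

  ◃-homo : ∀ s n → ⟦ s ◃ n ⟧ℤ ≈ ⟦ s ⟧ₛ * (n × 1#)
  ◃-homo s      zero    = sym (zeroʳ _)
  ◃-homo Sign.+ (suc n) = sym (*-identityˡ _)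
  ◃-homo Sign.- (suc n) = sym (-1*x≈-x _)

  sign-abs : ∀ i → ⟦ i ⟧ℤ ≈ ⟦ sign i ⟧ₛ * (∣ i ∣ × 1#)
  sign-abs i = trans (reflexive (≡.cong ⟦_⟧ℤ (≡.sym (ℤ.◃-inverse i))))
                     (◃-homo (sign i) ∣ i ∣)

  sign-homo : ∀ s t → ⟦ s Sign.* t ⟧ₛ ≈ ⟦ s ⟧ₛ * ⟦ t ⟧ₛ
  sign-homo Sign.+ t      = sym (*-identityˡ _)
  sign-homo Sign.- Sign.+ = sym (*-identityʳ _)
  sign-homo Sign.- Sign.- = begin
    1#             ≈⟨ -‿involutive 1# ⟨
    - - 1#         ≈⟨ -‿cong (-1*x≈-x 1#) ⟨
    - (- 1# * 1#)  ≈⟨ -‿distribʳ-* (- 1#) 1# ⟩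
    - 1# * - 1#    ∎

  *-homo : ∀ i j → ⟦ i ℤ.* j ⟧ℤ ≈ ⟦ i ⟧ℤ * ⟦ j ⟧ℤ
  *-homo i j = begin
    ⟦ sign i Sign.* sign j ◃ ∣ i ∣ ℕ.* ∣ j ∣ ⟧ℤ
      ≈⟨ ◃-homo (sign i Sign.* sign j) (∣ i ∣ ℕ.* ∣ j ∣) ⟩
    ⟦ sign i Sign.* sign j ⟧ₛ * ((∣ i ∣ ℕ.* ∣ j ∣) × 1#)
      ≈⟨ *-cong (sign-homo (sign i) (sign j)) (×1-homo-* ∣ i ∣ ∣ j ∣) ⟩
    (⟦ sign i ⟧ₛ * ⟦ sign j ⟧ₛ) * ((∣ i ∣ × 1#) * (∣ j ∣ × 1#))
      ≈⟨ *-interchange _ _ _ _ ⟩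
    (⟦ sign i ⟧ₛ * (∣ i ∣ × 1#)) * (⟦ sign j ⟧ₛ * (∣ j ∣ × 1#))
      ≈⟨ *-cong (sign-abs i) (sign-abs j) ⟨
    ⟦ i ⟧ℤ * ⟦ j ⟧ℤ
      ∎

  -‿homo : ∀ i → ⟦ ℤ.- i ⟧ℤ ≈ - ⟦ i ⟧ℤ
  -‿homo (+ zero)  = sym -0#≈0#
  -‿homo (+ suc n) = refl
  -‿homo -[1+ n ]  = sym (-‿involutive _)

  homomorphism : CommutativeRing.rawRing ℤ.+-*-commutativeRing
                   -Raw-AlmostCommutative⟶ fromCommutativeRing Rg
  homomorphism = record
    { ⟦_⟧    = ⟦_⟧ℤ
    ; +-homo = +-homo
    ; *-homo = *-homo
    ; -‿homo = -‿homo
    ; 0-homo = refl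
    ; 1-homo = refl
    }

  _≟_ : ∀ i j → Maybe (⟦ i ⟧ℤ ≈ ⟦ j ⟧ℤ)
  i ≟ j with i ℤ.≟ j
  ... | yes ≡.refl = just refl
  ... | no _       = nothing

  open import Algebra.Solver.Ring _ _ homomorphism _≟_ public

  ≈-modulo : ∀ {a x y} s → a ≈ 1# → x ≈ y + (a - 1#) * s → x ≈ y
  ≈-modulo {a} {x} {y} s a≈1 x≈y+[a-1]s = begin
    x                 ≈⟨ x≈y+[a-1]s ⟩
    y + (a - 1#) * s  ≈⟨ +-congˡ (*-congʳ (trans (+-congʳ a≈1) (-‿inverseʳ 1#))) ⟩
    y + 0# * s        ≈⟨ +-congˡ (zeroˡ s) ⟩
    y + 0#            ≈⟨ +-identityʳ y ⟩
    y                 ∎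

-- q and q⁻ are irrelevant here; they are only needed to open QMarkov, where M2 lives.
module Matrix2 {c ℓ} (Rg : CommutativeRing c ℓ) (q q⁻ : CommutativeRing.Carrier Rg) where
  open CommutativeRing Rg
  open QMarkov Rg q q⁻
  open IntegerRingSolver Rg using (Polynomial; solve; _:=_; _:+_; _:*_; _:-_; :-_)

  det : M2 → Carrier
  det (mat a b c d) = a * d - b * c

  adj : M2 → M2
  adj (mat a b c d) = mat d (- b) (- c) a

  infix 4 _≈ₘ_
  record _≈ₘ_ (X Y : M2) : Set ℓ where
    constructor mat-cong
    field
      a11≈ : M2.a11 X ≈ M2.a11 Y
      a12≈ : M2.a12 X ≈ M2.a12 Y
      a21≈ : M2.a21 X ≈ M2.a21 Y
      a22≈ : M2.a22 X ≈ M2.a22 Y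

  ≈ₘ-trans : ∀ {X Y Z} → X ≈ₘ Y → Y ≈ₘ Z → X ≈ₘ Z
  ≈ₘ-trans (mat-cong a b c d) (mat-cong a′ b′ c′ d′) =
    mat-cong (trans a a′) (trans b b′) (trans c c′) (trans d d′)

  ⊗-cong : ∀ {X X′ Y Y′} → X ≈ₘ X′ → Y ≈ₘ Y′ → X ⊗ Y ≈ₘ X′ ⊗ Y′
  ⊗-cong (mat-cong a b c d) (mat-cong e f g h) = mat-cong
    (+-cong (*-cong a e) (*-cong b g)) (+-cong (*-cong a f) (*-cong b h))
    (+-cong (*-cong c e) (*-cong d g)) (+-cong (*-cong c f) (*-cong d h))

  adj-cong : ∀ {X Y} → X ≈ₘ Y → adj X ≈ₘ adj Y
  adj-cong (mat-cong a b c d) = mat-cong d (-‿cong b) (-‿cong c) a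

  tr-cong : ∀ {X Y} → X ≈ₘ Y → tr X ≈ tr Y
  tr-cong (mat-cong a _ _ d) = +-cong a d

  det-cong : ∀ {X Y} → X ≈ₘ Y → det X ≈ det Y
  det-cong (mat-cong a b c d) = +-cong (*-cong a d) (-‿cong (*-cong b c))

  -- Matrices of solver expressions, with operations mirroring _⊗_, adj, tr and
  -- det clause by clause, so that matrix identities can be handed to the solver
  -- as they are stated.
  record Mₑ (n : ℕ) : Set c where
    constructor matₑ
    field a₁₁ a₁₂ a₂₁ a₂₂ : Polynomial n

  module _ {n : ℕ} where
    infixl 7 _⊗ₑ_
    _⊗ₑ_ : Mₑ n → Mₑ n → Mₑ n
    matₑ a b c d ⊗ₑ matₑ e f g h =
      matₑ (a :* e :+ b :* g) (a :* f :+ b :* h) (c :* e :+ d :* g) (c :* f :+ d :* h)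

    adjₑ : Mₑ n → Mₑ n
    adjₑ (matₑ a b c d) = matₑ d (:- b) (:- c) a

    trₑ : Mₑ n → Polynomial n
    trₑ (matₑ a _ _ d) = a :+ d

    detₑ : Mₑ n → Polynomial n
    detₑ (matₑ a b c d) = a :* d :- b :* c

  tr-⊗ : ∀ X Y → tr (X ⊗ Y) ≈ tr X * tr Y - tr (adj X ⊗ Y)
  tr-⊗ (mat a b c d) (mat e f g h) = solve 8 (λ a b c d e f g h →
    let X = matₑ a b c d; Y = matₑ e f g h in
    trₑ (X ⊗ₑ Y) := trₑ X :* trₑ Y :- trₑ (adjₑ X ⊗ₑ Y)) refl a b c d e f g h

  det-⊗ : ∀ X Y → det (X ⊗ Y) ≈ det X * det Y
  det-⊗ (mat a b c d) (mat e f g h) = solve 8 (λ a b c d e f g h →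
    let X = matₑ a b c d; Y = matₑ e f g h in
    detₑ (X ⊗ₑ Y) := detₑ X :* detₑ Y) refl a b c d e f g h

  tr-adj-⊗ˡ : ∀ X Y → tr (adj X ⊗ (X ⊗ Y)) ≈ det X * tr Y
  tr-adj-⊗ˡ (mat a b c d) (mat e f g h) = solve 8 (λ a b c d e f g h →
    let X = matₑ a b c d; Y = matₑ e f g h in
    trₑ (adjₑ X ⊗ₑ (X ⊗ₑ Y)) := detₑ X :* trₑ Y) refl a b c d e f g h

  tr-adj-⊗ʳ : ∀ X Y → tr (adj (X ⊗ Y) ⊗ Y) ≈ det Y * tr X
  tr-adj-⊗ʳ (mat a b c d) (mat e f g h) = solve 8 (λ a b c d e f g h →
    let X = matₑ a b c d; Y = matₑ e f g h in
    trₑ (adjₑ (X ⊗ₑ Y) ⊗ₑ Y) := detₑ Y :* trₑ X) refl a b c d e f g h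

module FareyRecursion {c ℓ} (Rg : CommutativeRing c ℓ) (q q⁻ : CommutativeRing.Carrier Rg) where
  open CommutativeRing Rg
  open QMarkov Rg q q⁻
  open Matrix2 Rg q q⁻
  open IntegerRingSolver Rg using (solve; _:=_; _:*_; _:-_)
  open import Relation.Binary.Reasoning.Setoid setoid

  -- X, Y are the matrices at two Farey neighbours and x, y, z the q-Markov
  -- numbers at these neighbours and at their difference; since det X ≈ 1,
  -- adj X ⊗ Y plays the role of X⁻¹ Y.
  record IsMarkovPair (X Y : M2) (x y z : Carrier) : Set ℓ where
    field
      det-X     : det X ≈ 1#
      det-Y     : det Y ≈ 1#
      tr-X      : tr X ≈ κ * x
      tr-Y      : tr Y ≈ κ * y
      tr-adjX⊗Y : tr (adj X ⊗ Y) ≈ κ * z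

    tr-X⊗Y : tr (X ⊗ Y) ≈ κ * (κ * x * y - z)
    tr-X⊗Y = begin
      tr (X ⊗ Y)                    ≈⟨ tr-⊗ X Y ⟩
      tr X * tr Y - tr (adj X ⊗ Y)  ≈⟨ +-cong (*-cong tr-X tr-Y) (-‿cong tr-adjX⊗Y) ⟩
      κ * x * (κ * y) - κ * z       ≈⟨ solve 4 (λ k x y z → k :* x :* (k :* y) :- k :* z
                                                          := k :* (k :* x :* y :- z))
                                               refl κ x y z ⟩
      κ * (κ * x * y - z)           ∎

    det-X⊗Y : det (X ⊗ Y) ≈ 1#
    det-X⊗Y = trans (det-⊗ X Y) (trans (*-cong det-X det-Y) (*-identityˡ 1#))

  open IsMarkovPair

  descendˡ : ∀ {X Y x y z} → IsMarkovPair X Y x y z →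
             IsMarkovPair X (X ⊗ Y) x (κ * x * y - z) y
  descendˡ {X} {Y} P = record
    { det-X     = det-X P
    ; det-Y     = det-X⊗Y P
    ; tr-X      = tr-X P
    ; tr-Y      = tr-X⊗Y P
    ; tr-adjX⊗Y = trans (tr-adj-⊗ˡ X Y) (trans (*-cong (det-X P) (tr-Y P)) (*-identityˡ _))
    }

  descendʳ : ∀ {X Y x y z} → IsMarkovPair X Y x y z →
             IsMarkovPair (X ⊗ Y) Y (κ * x * y - z) y x
  descendʳ {X} {Y} P = record
    { det-X     = det-X⊗Y P
    ; det-Y     = det-Y P
    ; tr-X      = tr-X⊗Y P
    ; tr-Y      = tr-Y P
    ; tr-adjX⊗Y = trans (tr-adj-⊗ʳ X Y) (trans (*-cong (det-Y P) (tr-X P)) (*-identityˡ _))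
    }

  tr-CNode : ∀ p {X Y x y z} → IsMarkovPair X Y x y z →
             tr (CNode p X Y) ≈ κ * mNode p x y z
  tr-CNode []      P = tr-X⊗Y P
  tr-CNode (L ∷ p) P = tr-CNode p (descendˡ P)
  tr-CNode (R ∷ p) P = tr-CNode p (descendʳ P)

module QNumbers {c ℓ} (Rg : CommutativeRing c ℓ) {q q⁻ : CommutativeRing.Carrier Rg}
                (qq⁻≈1 : CommutativeRing._≈_ Rg (CommutativeRing._*_ Rg q q⁻) (CommutativeRing.1# Rg))
                where
  open CommutativeRing Rg
  open QMarkov Rg q q⁻
  open IntegerRingSolver Rg using (solve; _:=_; _:+_; _:*_; _:-_; :-_; con; ≈-modulo)
  open import Relation.Binary.Reasoning.Setoid setoid

  q*[q⁻*x]≈x : ∀ x → q * (q⁻ * x) ≈ x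
  q*[q⁻*x]≈x x = trans (sym (*-assoc q q⁻ x)) (trans (*-congʳ qq⁻≈1) (*-identityˡ x))

  q⁻*[q*x]≈x : ∀ x → q⁻ * (q * x) ≈ x
  q⁻*[q*x]≈x x =
    trans (sym (*-assoc q⁻ q x)) (trans (*-congʳ (trans (*-comm q⁻ q) qq⁻≈1)) (*-identityˡ x))

  qpow-suc : ∀ z → qpow (sucℤ z) ≈ q * qpow z
  qpow-suc (+ k)        = refl
  qpow-suc -[1+ 0 ]     = sym (q*[q⁻*x]≈x 1#)
  qpow-suc -[1+ suc k ] = sym (q*[q⁻*x]≈x _)

  qpow-pred : ∀ z → qpow (pred z) ≈ q⁻ * qpow z
  qpow-pred (+ 0)     = refl
  qpow-pred (+ suc k) = sym (q⁻*[q*x]≈x _)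
  qpow-pred -[1+ k ]  = refl

  qpow-+ : ∀ a b → qpow (a ℤ.+ b) ≈ qpow a * qpow b
  qpow-+ (+ 0) b = begin
    qpow (+ 0 ℤ.+ b)  ≡⟨ ≡.cong qpow (ℤ.+-identityˡ b) ⟩
    qpow b            ≈⟨ *-identityˡ _ ⟨
    1# * qpow b       ∎
  qpow-+ (+ suc k) b = begin
    qpow (+ suc k ℤ.+ b)     ≡⟨ ≡.cong qpow (ℤ.suc-+ k b) ⟩
    qpow (sucℤ (+ k ℤ.+ b))  ≈⟨ qpow-suc (+ k ℤ.+ b) ⟩
    q * qpow (+ k ℤ.+ b)     ≈⟨ *-congˡ (qpow-+ (+ k) b) ⟩
    q * (pow k q * qpow b)   ≈⟨ *-assoc _ _ _ ⟨
    q * pow k q * qpow b     ∎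
  qpow-+ -[1+ 0 ] b = trans (qpow-pred b) (*-congʳ (sym (*-identityʳ q⁻)))
  qpow-+ -[1+ suc k ] b = begin
    qpow (pred -[1+ k ] ℤ.+ b)     ≡⟨ ≡.cong qpow (ℤ.pred-+ -[1+ k ] b) ⟩
    qpow (pred (-[1+ k ] ℤ.+ b))   ≈⟨ qpow-pred (-[1+ k ] ℤ.+ b) ⟩
    q⁻ * qpow (-[1+ k ] ℤ.+ b)     ≈⟨ *-congˡ (qpow-+ -[1+ k ] b) ⟩
    q⁻ * (qpow -[1+ k ] * qpow b)  ≈⟨ *-assoc _ _ _ ⟨
    q⁻ * qpow -[1+ k ] * qpow b    ∎

  qpow-inverse : ∀ z → qpow (ℤ.- z) * qpow z ≈ 1#
  qpow-inverse z = trans (sym (qpow-+ (ℤ.- z) z)) (reflexive (≡.cong qpow (ℤ.+-inverseˡ z)))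

  qnatP-suc : ∀ k → qnatP (suc k) ≈ 1# + q * qnatP k
  qnatP-suc zero    = +-congˡ (sym (zeroʳ q))
  qnatP-suc (suc k) = begin
    q * pow k q + qnatP (suc k)       ≈⟨ +-congˡ (qnatP-suc k) ⟩
    q * pow k q + (1# + q * qnatP k)  ≈⟨ solve 3 (λ q x y → q :* x :+ (con (+ 1) :+ q :* y)
                                                        := con (+ 1) :+ q :* (x :+ y))
                                                 refl q (pow k q) (qnatP k) ⟩
    1# + q * (pow k q + qnatP k)      ∎

  qint-pred : ∀ z → qint (pred z) ≈ q⁻ * (qint z - 1#)
  qint-pred (+ 0) = solve 1 (λ q⁻ → :- (q⁻ :* con (+ 1) :* (con (+ 1) :+ con (+ 0)))
                                    := q⁻ :* (con (+ 0) :- con (+ 1)))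
                            refl q⁻
  qint-pred (+ suc k) = begin
    qnatP k                       ≈⟨ q⁻*[q*x]≈x _ ⟨
    q⁻ * (q * qnatP k)            ≈⟨ *-congˡ (solve 1 (λ x → x := con (+ 1) :+ x :- con (+ 1)) refl _) ⟩
    q⁻ * (1# + q * qnatP k - 1#)  ≈⟨ *-congˡ (+-congʳ (qnatP-suc k)) ⟨
    q⁻ * (qnatP (suc k) - 1#)     ∎
  qint-pred -[1+ k ] =
    ≈-modulo (- q⁻) (qpow-inverse (+ suc k))
      (solve 4 (λ q⁻ a b N → :- (q⁻ :* a :* (b :+ N))
                             := q⁻ :* (:- (a :* N) :- con (+ 1)) :+ (a :* b :- con (+ 1)) :* (:- q⁻))
             refl q⁻ (pow (suc k) q⁻) (pow (suc k) q) (qnatP (suc k)))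

  qint-suc : ∀ z → qint (sucℤ z) ≈ 1# + q * qint z
  qint-suc z = begin
    qint (sucℤ z)                         ≈⟨ solve 1 (λ x → x := con (+ 1) :+ (x :- con (+ 1))) refl _ ⟩
    1# + (qint (sucℤ z) - 1#)             ≈⟨ +-congˡ (q*[q⁻*x]≈x _) ⟨
    1# + q * (q⁻ * (qint (sucℤ z) - 1#))  ≈⟨ +-congˡ (*-congˡ (qint-pred (sucℤ z))) ⟨
    1# + q * qint (pred (sucℤ z))         ≡⟨ ≡.cong (λ w → 1# + q * qint w) (ℤ.pred-suc z) ⟩
    1# + q * qint z                       ∎

  qint-+ : ∀ a b → qint (a ℤ.+ b) ≈ qint a + qpow a * qint b
  qint-+ (+ 0) b = begin
    qint (+ 0 ℤ.+ b)  ≡⟨ ≡.cong qint (ℤ.+-identityˡ b) ⟩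
    qint b            ≈⟨ trans (+-identityˡ _) (*-identityˡ _) ⟨
    0# + 1# * qint b  ∎
  qint-+ (+ suc k) b = begin
    qint (+ suc k ℤ.+ b)                           ≡⟨ ≡.cong qint (ℤ.suc-+ k b) ⟩
    qint (sucℤ (+ k ℤ.+ b))                        ≈⟨ qint-suc (+ k ℤ.+ b) ⟩
    1# + q * qint (+ k ℤ.+ b)                      ≈⟨ +-congˡ (*-congˡ (qint-+ (+ k) b)) ⟩
    1# + q * (qint (+ k) + qpow (+ k) * qint b)    ≈⟨ solve 4 (λ q x y z →
                                                         con (+ 1) :+ q :* (x :+ y :* z)
                                                           := con (+ 1) :+ q :* x :+ q :* y :* z)
                                                       refl q _ _ _ ⟩
    1# + q * qint (+ k) + q * qpow (+ k) * qint b  ≈⟨ +-congʳ (qint-suc (+ k)) ⟨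
    qint (+ suc k) + qpow (+ suc k) * qint b       ∎
  qint-+ -[1+ 0 ] b = begin
    qint (pred b)                           ≈⟨ qint-pred b ⟩
    q⁻ * (qint b - 1#)                      ≈⟨ solve 2 (λ q⁻ x →
                                                  q⁻ :* (x :- con (+ 1))
                                                    := :- (q⁻ :* con (+ 1) :* (con (+ 1) :+ con (+ 0)))
                                                       :+ q⁻ :* con (+ 1) :* x)
                                                refl q⁻ _ ⟩
    qint -[1+ 0 ] + qpow -[1+ 0 ] * qint b  ∎
  qint-+ -[1+ suc k ] b = begin
    qint (pred -[1+ k ] ℤ.+ b)                              ≡⟨ ≡.cong qint (ℤ.pred-+ -[1+ k ] b) ⟩
    qint (pred (-[1+ k ] ℤ.+ b))                            ≈⟨ qint-pred (-[1+ k ] ℤ.+ b) ⟩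
    q⁻ * (qint (-[1+ k ] ℤ.+ b) - 1#)                       ≈⟨ *-congˡ (+-congʳ (qint-+ -[1+ k ] b)) ⟩
    q⁻ * (qint -[1+ k ] + qpow -[1+ k ] * qint b - 1#)      ≈⟨ solve 4 (λ q⁻ x y z →
                                                                  q⁻ :* (x :+ y :* z :- con (+ 1))
                                                                    := q⁻ :* (x :- con (+ 1)) :+ q⁻ :* y :* z)
                                                                refl q⁻ _ _ _ ⟩
    q⁻ * (qint -[1+ k ] - 1#) + q⁻ * qpow -[1+ k ] * qint b ≈⟨ +-congʳ (qint-pred -[1+ k ]) ⟨
    qint (pred -[1+ k ]) + qpow (pred -[1+ k ]) * qint b    ∎

module CohnTraces {c ℓ} (Rg : CommutativeRing c ℓ) {q q⁻ : CommutativeRing.Carrier Rg}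
                  (qq⁻≈1 : CommutativeRing._≈_ Rg (CommutativeRing._*_ Rg q q⁻) (CommutativeRing.1# Rg))
                  where
  open CommutativeRing Rg
  open QMarkov Rg q q⁻
  open Matrix2 Rg q q⁻
  open FareyRecursion Rg q q⁻
  open QNumbers Rg qq⁻≈1
  open IntegerRingSolver Rg
    using (Polynomial; solve; _:=_; _:+_; _:*_; _:-_; :-_; _:^_; con; ≈-modulo)
  open import Data.Integer.Tactic.RingSolver using (solve-∀)
  open import Relation.Binary.Reasoning.Setoid setoid

  -- A n in the coordinates u = q^{-n}, P = q^n, N = [n]_q, T = [3-n]_q.
  Â : (u P N T : Carrier) → M2
  Â u P N T = mat (pow 2 q * u * N) (pow 1 q * u) (N * T - P * pow 1 q⁻) (q⁻ * T)

  Âₑ : ∀ {n} (q q⁻ u P N T : Polynomial n) → Mₑ n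
  Âₑ q q⁻ u P N T = matₑ (q :^ 2 :* u :* N) (q :^ 1 :* u) (N :* T :- P :* q⁻ :^ 1) (q⁻ :* T)

  κₑ : ∀ {n} (q q⁻ : Polynomial n) → Polynomial n
  κₑ q q⁻ = q⁻ :* (q :^ 2 :+ (q :^ 1 :+ (q :^ 0 :+ con (+ 0))))

  Â-cong : ∀ {u u′ P P′ N N′ T T′} → u ≈ u′ → P ≈ P′ → N ≈ N′ → T ≈ T′ →
           Â u P N T ≈ₘ Â u′ P′ N′ T′
  Â-cong u P N T = mat-cong (*-cong (*-congˡ u) N) (*-congˡ u)
                            (+-cong (*-cong N T) (-‿cong (*-congʳ P))) (*-congˡ T)

  A≈Â : ∀ n → A n ≈ₘ Â (qpow (ℤ.- n)) (qpow n) (qint n) (qint (+ 3 ℤ.- n))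
  A≈Â n = mat-cong (*-congʳ (qpow-+ (+ 2) (ℤ.- n))) (qpow-+ (+ 1) (ℤ.- n))
                   (+-congˡ (-‿cong (qpow-+ n -[1+ 0 ]))) refl

  det-Â : ∀ {u P N T} → u * P ≈ 1# → det (Â u P N T) ≈ 1#
  det-Â {u} {P} {N} {T} uP≈1 =
    ≈-modulo 1# uP≈1 (≈-modulo (q * u * N * T + u * P) qq⁻≈1
      (solve 6 (λ q q⁻ u P N T →
         detₑ (Âₑ q q⁻ u P N T)
           := con (+ 1) :+ (u :* P :- con (+ 1)) :* con (+ 1)
                        :+ (q :* q⁻ :- con (+ 1)) :* (q :* u :* N :* T :+ u :* P))
       refl q q⁻ u P N T))

  tr-Â : ∀ {u P N T} → qint (+ 3) ≈ T + pow 3 q * u * N → tr (Â u P N T) ≈ κ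
  tr-Â {u} {P} {N} {T} [3]≈T+q³uN = begin
    tr (Â u P N T)              ≈⟨ ≈-modulo (- (pow 2 q * u * N)) qq⁻≈1
                                     (solve 6 (λ q q⁻ u P N T →
                                        trₑ (Âₑ q q⁻ u P N T)
                                          := q⁻ :* (T :+ q :^ 3 :* u :* N)
                                             :+ (q :* q⁻ :- con (+ 1)) :* (:- (q :^ 2 :* u :* N)))
                                      refl q q⁻ u P N T) ⟩
    q⁻ * (T + pow 3 q * u * N)  ≈⟨ *-congˡ [3]≈T+q³uN ⟨
    κ                           ∎

  -- Modulo q q⁻ = u P = 1 the left side is u ((N + P) - N) ((1 + q T) - q T) + q + q⁻.
  tr-adj-Â : ∀ {u P N T} → u * P ≈ 1# →
             tr (adj (Â u P N (1# + q * T)) ⊗ Â (q⁻ * u) (q * P) (N + P) T) ≈ κ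
  tr-adj-Â {u} {P} {N} {T} uP≈1 =
    ≈-modulo (q * q⁻ * (q * q⁻ + q⁻ + q)) uP≈1
      (≈-modulo ((q * q⁻ + 1#) * q * u * (N + P) * T + q * q⁻ * (u * N + 1#) + q⁻) qq⁻≈1
        (solve 6 (λ q q⁻ u P N T →
           trₑ (adjₑ (Âₑ q q⁻ u P N (con (+ 1) :+ q :* T)) ⊗ₑ Âₑ q q⁻ (q⁻ :* u) (q :* P) (N :+ P) T)
             := κₑ q q⁻
                :+ (u :* P :- con (+ 1)) :* (q :* q⁻ :* (q :* q⁻ :+ q⁻ :+ q))
                :+ (q :* q⁻ :- con (+ 1))
                   :* ((q :* q⁻ :+ con (+ 1)) :* q :* u :* (N :+ P) :* T
                       :+ q :* q⁻ :* (u :* N :+ con (+ 1)) :+ q⁻))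
         refl q q⁻ u P N T))

  det-A : ∀ n → det (A n) ≈ 1#
  det-A n = trans (det-cong (A≈Â n)) (det-Â (qpow-inverse n))

  tr-A : ∀ n → tr (A n) ≈ κ
  tr-A n = trans (tr-cong (A≈Â n)) (tr-Â {P = qpow n} [3]≈)
    where
    3-n+n≡3 : ∀ m → + 3 ℤ.- m ℤ.+ m ≡ + 3
    3-n+n≡3 = solve-∀

    [3]≈ : qint (+ 3) ≈ qint (+ 3 ℤ.- n) + pow 3 q * qpow (ℤ.- n) * qint n
    [3]≈ = begin
      qint (+ 3)                                          ≡⟨ ≡.cong qint (3-n+n≡3 n) ⟨
      qint (+ 3 ℤ.- n ℤ.+ n)                              ≈⟨ qint-+ (+ 3 ℤ.- n) n ⟩
      qint (+ 3 ℤ.- n) + qpow (+ 3 ℤ.- n) * qint n        ≈⟨ +-congˡ (*-congʳ (qpow-+ (+ 3) (ℤ.- n))) ⟩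
      qint (+ 3 ℤ.- n) + pow 3 q * qpow (ℤ.- n) * qint n  ∎

  A≈Â-shifted : ∀ n → A n ≈ₘ Â (qpow (ℤ.- n)) (qpow n) (qint n)
                                (1# + q * qint (+ 3 ℤ.- (n ℤ.+ + 1)))
  A≈Â-shifted n = ≈ₘ-trans (A≈Â n) (Â-cong refl refl refl T≈)
    where
    3-n≡1+[3-[n+1]] : ∀ m → + 3 ℤ.- m ≡ + 1 ℤ.+ (+ 3 ℤ.- (m ℤ.+ + 1))
    3-n≡1+[3-[n+1]] = solve-∀

    T≈ : qint (+ 3 ℤ.- n) ≈ 1# + q * qint (+ 3 ℤ.- (n ℤ.+ + 1))
    T≈ = trans (reflexive (≡.cong qint (3-n≡1+[3-[n+1]] n))) (qint-suc (+ 3 ℤ.- (n ℤ.+ + 1)))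

  A[n+1]≈Â : ∀ n → A (n ℤ.+ + 1) ≈ₘ Â (q⁻ * qpow (ℤ.- n)) (q * qpow n) (qint n + qpow n)
                                       (qint (+ 3 ℤ.- (n ℤ.+ + 1)))
  A[n+1]≈Â n = ≈ₘ-trans (A≈Â (n ℤ.+ + 1)) (Â-cong u≈ P≈ N≈ refl)
    where
    -[n+1]≡pred[-n] : ∀ m → ℤ.- (m ℤ.+ + 1) ≡ -[1+ 0 ] ℤ.+ ℤ.- m
    -[n+1]≡pred[-n] = solve-∀

    u≈ : qpow (ℤ.- (n ℤ.+ + 1)) ≈ q⁻ * qpow (ℤ.- n)
    u≈ = trans (reflexive (≡.cong qpow (-[n+1]≡pred[-n] n))) (qpow-pred (ℤ.- n))

    P≈ : qpow (n ℤ.+ + 1) ≈ q * qpow n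
    P≈ = trans (reflexive (≡.cong qpow (ℤ.+-comm n (+ 1)))) (qpow-suc n)

    N≈ : qint (n ℤ.+ + 1) ≈ qint n + qpow n
    N≈ = trans (qint-+ n (+ 1)) (+-congˡ (trans (*-congˡ (+-identityʳ 1#)) (*-identityʳ _)))

  tr-adj-A : ∀ n → tr (adj (A n) ⊗ A (n ℤ.+ + 1)) ≈ κ
  tr-adj-A n = trans (tr-cong (⊗-cong (adj-cong (A≈Â-shifted n)) (A[n+1]≈Â n)))
                     (tr-adj-Â (qpow-inverse n))

  κ*1*1-1≈q+q⁻ : κ * 1# * 1# - 1# ≈ q + q⁻
  κ*1*1-1≈q+q⁻ = ≈-modulo (q + 1#) qq⁻≈1
    (solve 2 (λ q q⁻ → κₑ q q⁻ :* con (+ 1) :* con (+ 1) :- con (+ 1)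
                       := q :+ q⁻ :+ (q :* q⁻ :- con (+ 1)) :* (q :+ con (+ 1)))
     refl q q⁻)

  -- (A n, A (n+1)) realises the triple (1, 1, 1) one level above the Farey
  -- tree; descending left from it gives the root pair (A n, B n).
  A-pair : ∀ n → IsMarkovPair (A n) (A (n ℤ.+ + 1)) 1# 1# 1#
  A-pair n = record
    { det-X     = det-A n
    ; det-Y     = det-A (n ℤ.+ + 1)
    ; tr-X      = κ*1 (tr-A n)
    ; tr-Y      = κ*1 (tr-A (n ℤ.+ + 1))
    ; tr-adjX⊗Y = κ*1 (tr-adj-A n)
    }
    where
    κ*1 : ∀ {x} → x ≈ κ → x ≈ κ * 1#
    κ*1 x≈κ = trans x≈κ (sym (*-identityʳ κ))

  A-B-pair : ∀ n → IsMarkovPair (A n) (B n) 1# (q + q⁻) 1#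
  A-B-pair n = record
    { det-X     = det-X P
    ; det-Y     = det-Y P
    ; tr-X      = tr-X P
    ; tr-Y      = trans (tr-Y P) (*-congˡ κ*1*1-1≈q+q⁻)
    ; tr-adjX⊗Y = tr-adjX⊗Y P
    }
    where
    open IsMarkovPair
    P = descendˡ (A-pair n)

  tr-C : ∀ n t → tr (C n t) ≈ κ * mq t
  tr-C n t with position t
  ... | zeroPt  = IsMarkovPair.tr-X (A-B-pair n)
  ... | onePt   = IsMarkovPair.tr-Y (A-B-pair n)
  ... | inner p = tr-CNode p (A-B-pair n)

theorem4p4 : ∀ {c ℓ} (Rg : CommutativeRing c ℓ) (q q⁻ : CommutativeRing.Carrier Rg)
             → CommutativeRing._≈_ Rg (CommutativeRing._*_ Rg q q⁻) (CommutativeRing.1# Rg)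
             → (n : ℤ) (t : ℚ) → 0ℚ ≤ t → t ≤ 1ℚ
             → CommutativeRing._≈_ Rg (QMarkov.tr Rg q q⁻ (QMarkov.C Rg q q⁻ n t))
                 (CommutativeRing._*_ Rg (QMarkov.κ Rg q q⁻) (QMarkov.mq Rg q q⁻ t))
theorem4p4 Rg q q⁻ qq⁻≈1 n t _ _ = CohnTraces.tr-C Rg qq⁻≈1 n t
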